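{- Let $(\sigma_n(x))_{n\ge 0}$ be the polynomials defined by $\sigma_0=3$, $\sigma_1=2x$, $\sigma_2=4x^2$ and $\sigma_n=2x\,\sigma_{n-1}+\sigma_{n-3}$ for $n\ge 3$. Then for all $n\ge 1$, $$\sigma_n(x)=\sum_{0\le \ell\le n/3}\frac{n}{n-2\ell}\binom{n-2\ell}{\ell}(2x)^{n-3\ell}.$$ -}

module Defs where

open import Data.Nat as ℕ using (ℕ; zero; suc; _∸_; _/_)
import Data.Integer as ℤ
open import Data.Nat.Combinatorics using (_C_)
open import Data.Rational as ℚ using (ℚ; 0ℚ; _+_; _*_)
open import Data.Rational.Base using () renaming (_/_ to _//_)
open import Relation.Binary.PropositionalEquality using (_≡_)

-- Polynomials in one variable x with rational coefficients,
-- represented by coefficient sequences: p k = coefficient of x^k.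
Poly : Set
Poly = ℕ → ℚ

_≈ₚ_ : Poly → Poly → Set
p ≈ₚ q = ∀ k → p k ≡ q k

infix 4 _≈ₚ_

const : ℚ → Poly
const c zero    = c
const c (suc _) = 0ℚ

_⊕_ : Poly → Poly → Poly
(p ⊕ q) k = p k + q k

infixl 6 _⊕_

_·_ : ℚ → Poly → Poly
(c · p) k = c * p k

infixr 7 _·_

X*_ : Poly → Poly
(X* p) zero    = 0ℚ
(X* p) (suc k) = p k

twoX*_ : Poly → Poly
twoX* p = (ℚ.1ℚ + ℚ.1ℚ) · (X* p)

twoXpow : ℕ → Poly
twoXpow zero    = const ℚ.1ℚ
twoXpow (suc m) = twoX* (twoXpow m)

nat : ℕ → ℚ
nat m = ℤ.+ m // 1

-- the rational a / d for d ≠ 0 (the value for d = 0 is an arbitrary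
-- convention and never used: below d = n - 2ℓ ≥ 1 whenever n ≥ 1, ℓ ≤ n/3)
frac : ℕ → ℕ → ℚ
frac a zero    = 0ℚ
frac a (suc d) = ℤ.+ a // suc d

σ : ℕ → Poly
σ zero                = const (nat 3)
σ (suc zero)          = twoXpow 1
σ (suc (suc zero))    = twoXpow 2
σ (suc (suc (suc n))) = twoX* (σ (suc (suc n))) ⊕ σ n

ΣP : ℕ → (ℕ → Poly) → Poly
ΣP zero    f = const 0ℚ
ΣP (suc m) f = ΣP m f ⊕ f m

rhs : ℕ → Poly
rhs n = ΣP (suc (n / 3)) λ ℓ →
  (frac n (n ∸ 2 ℕ.* ℓ) * nat ((n ∸ 2 ℕ.* ℓ) C ℓ)) · twoXpow (n ∸ 3 ℕ.* ℓ)

-- Let c(k, ℓ) = C(k + ℓ, ℓ) + 2 C(k + ℓ − 1, ℓ − 1) for ℓ ≥ 1, c(0, 0) = 3, c(k + 1, 0) = 1,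
-- and Sₙ = Σ_{3ℓ ≤ n} c(n − 3ℓ, ℓ) (2x)^(n − 3ℓ).  Pascal's rule gives
-- c(k + 1, ℓ + 1) = c(k, ℓ + 1) + c(k + 1, ℓ), which is exactly what makes S satisfy σ's
-- recurrence Sₙ₊₃ = 2x Sₙ₊₂ + Sₙ; as S agrees with σ for n ≤ 2, σ = S.  The absorption
-- identity (k + 1) C(m + 1, k + 1) = (m + 1) C(m, k) gives n C(n − 2ℓ, ℓ) = (n − 2ℓ) c(n − 3ℓ, ℓ),
-- so the summands of the paper's formula are the terms of S.
module Submission where

open import Data.Nat using (ℕ; _≥_)
open import Defs

module Binomial where
  open import Data.Nat
  open import Data.Nat.Properties using (*-zeroʳ; *-identityʳ; +-identityʳ; +-comm; +-suc)
  open import Data.Nat.Combinatorics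
    using (_C_; nC1≡n; nCn≡1) renaming (nCk+nC[k+1]≡[n+1]C[k+1] to pascal)
  open import Data.Nat.Tactic.RingSolver using (solve-∀)
  open import Relation.Binary.PropositionalEquality
    using (_≡_; refl; sym; trans; cong; cong₂; module ≡-Reasoning)
  open ≡-Reasoning

  C-absorption : ∀ n k → suc k * (suc n C suc k) ≡ suc n * (n C k)
  C-absorption zero    zero    = refl
  C-absorption zero    (suc k) = *-zeroʳ (suc (suc k))
  C-absorption (suc n) zero    =
    trans (+-identityʳ _) (trans (nC1≡n (suc (suc n))) (sym (*-identityʳ (suc (suc n)))))
  C-absorption (suc n) (suc k) = begin
    suc (suc k) * (suc m C suc (suc k))
      ≡⟨ cong (suc (suc k) *_) (sym (pascal m (suc k))) ⟩
    suc (suc k) * (A + m C suc (suc k))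
      ≡⟨ distribute k A (m C suc (suc k)) ⟩
    (suc k * A + A) + suc (suc k) * (m C suc (suc k))
      ≡⟨ cong₂ (λ a b → (a + A) + b) (C-absorption n k) (C-absorption n (suc k)) ⟩
    (m * (n C k) + A) + m * (n C suc k)
      ≡⟨ collect m A (n C k) (n C suc k) ⟩
    m * (n C k + n C suc k) + A
      ≡⟨ cong (λ c → m * c + A) (pascal n k) ⟩
    m * A + A
      ≡⟨ +-comm (m * A) A ⟩
    suc m * A ∎
    where
    m = suc n
    A = m C suc k
    distribute : ∀ k a b → suc (suc k) * (a + b) ≡ (suc k * a + a) + suc (suc k) * b
    distribute = solve-∀
    collect : ∀ m a c d → (m * c + a) + m * d ≡ m * (c + d) + a
    collect = solve-∀

  -- coeff k ℓ is the paper's n/(n − 2ℓ) · C(n − 2ℓ, ℓ) at n = 3ℓ + k, written without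
  -- division; coeff 0 0 = 3 is not of that form (0/0) but is forced by σ₀ = 3.
  coeff : ℕ → ℕ → ℕ
  coeff k       (suc j) = suc (j + k) C suc j + 2 * ((j + k) C j)
  coeff zero    zero    = 3
  coeff (suc k) zero    = 1

  coeff-zero : ∀ ℓ → coeff 0 ℓ ≡ 3
  coeff-zero zero    = refl
  coeff-zero (suc j) rewrite +-identityʳ j = cong₂ (λ a b → a + 2 * b) (nCn≡1 (suc j)) (nCn≡1 j)

  coeff-suc-suc : ∀ k ℓ → coeff (suc k) (suc ℓ) ≡ coeff k (suc ℓ) + coeff (suc k) ℓ
  coeff-suc-suc k zero    = begin
    suc (suc k) C 1 + 2   ≡⟨ cong (_+ 2) (nC1≡n (suc (suc k))) ⟩
    suc (suc k) + 2       ≡⟨ +-comm (suc k + 2) 1 ⟨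
    (suc k + 2) + 1       ≡⟨ cong (λ a → a + 2 + 1) (nC1≡n (suc k)) ⟨
    (suc k C 1 + 2) + 1   ∎
  coeff-suc-suc k (suc j) rewrite +-suc j k = begin
    suc (suc N) C suc (suc j) + 2 * A
      ≡⟨ cong (_+ 2 * A) (pascal (suc N) (suc j)) ⟨
    (A + B) + 2 * A
      ≡⟨ cong (λ a → (A + B) + 2 * a) (pascal N j) ⟨
    (A + B) + 2 * (N C j + N C suc j)
      ≡⟨ rearrange A B (N C j) (N C suc j) ⟩
    (B + 2 * (N C suc j)) + (A + 2 * (N C j)) ∎
    where
    N = suc (j + k)
    A = suc N C suc j
    B = suc N C suc (suc j)
    rearrange : ∀ a b c d → (a + b) + 2 * (c + d) ≡ (b + 2 * d) + (a + 2 * c)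
    rearrange = solve-∀

  coeff-closedForm : ∀ k ℓ → (3 * ℓ + k) * ((ℓ + k) C ℓ) ≡ (ℓ + k) * coeff k ℓ
  coeff-closedForm zero    zero    = refl
  coeff-closedForm (suc k) zero    = refl
  coeff-closedForm k       (suc j) = begin
    (3 * suc j + k) * A              ≡⟨ split j k A ⟩
    m * A + 2 * (suc j * A)          ≡⟨ cong (λ x → m * A + 2 * x) (C-absorption (j + k) j) ⟩
    m * A + 2 * (m * ((j + k) C j))  ≡⟨ factor m A ((j + k) C j) ⟩
    m * coeff k (suc j)              ∎
    where
    m = suc (j + k)
    A = m C suc j
    split : ∀ j k a → (3 * suc j + k) * a ≡ suc (j + k) * a + 2 * (suc j * a)
    split = solve-∀
    factor : ∀ m a c → m * a + 2 * (m * c) ≡ m * (a + 2 * c)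
    factor = solve-∀

module RationalEmbedding where
  open import Data.Nat as ℕ using (ℕ; suc; NonZero)
  open import Data.Integer as ℤ using (+_)
  import Data.Integer.Properties as ℤ
  open import Data.Integer.Tactic.RingSolver using (solve-∀)
  open import Data.Rational using (_+_; _*_; fromℚᵘ)
  open import Data.Rational.Properties
    using (toℚᵘ-injective; toℚᵘ-fromℚᵘ; toℚᵘ-homo-+; toℚᵘ-homo-*; fromℚᵘ-cong)
  open import Data.Rational.Unnormalised as ℚᵘ using (ℚᵘ; mkℚᵘ; *≡*)
  import Data.Rational.Unnormalised.Properties as ℚᵘ
  open import Relation.Binary.PropositionalEquality
    using (_≡_; sym; trans; cong; module ≡-Reasoning)

  -- nat m and frac a (suc d) are fromℚᵘ of these fractions by definition, so identities
  -- between them reduce to cross-multiplication in ℤ.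
  natᵘ : ℕ → ℚᵘ
  natᵘ m = mkℚᵘ (+ m) 0

  fracᵘ : ℕ → ℕ → ℚᵘ
  fracᵘ a d-1 = mkℚᵘ (+ a) d-1

  fromℚᵘ-homo-+ : ∀ p q → fromℚᵘ (p ℚᵘ.+ q) ≡ fromℚᵘ p + fromℚᵘ q
  fromℚᵘ-homo-+ p q = toℚᵘ-injective (ℚᵘ.≃-trans (toℚᵘ-fromℚᵘ (p ℚᵘ.+ q)) (ℚᵘ.≃-sym
    (ℚᵘ.≃-trans (toℚᵘ-homo-+ (fromℚᵘ p) (fromℚᵘ q))
                (ℚᵘ.+-cong (toℚᵘ-fromℚᵘ p) (toℚᵘ-fromℚᵘ q)))))

  fromℚᵘ-homo-* : ∀ p q → fromℚᵘ (p ℚᵘ.* q) ≡ fromℚᵘ p * fromℚᵘ q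
  fromℚᵘ-homo-* p q = toℚᵘ-injective (ℚᵘ.≃-trans (toℚᵘ-fromℚᵘ (p ℚᵘ.* q)) (ℚᵘ.≃-sym
    (ℚᵘ.≃-trans (toℚᵘ-homo-* (fromℚᵘ p) (fromℚᵘ q))
                (ℚᵘ.*-cong (toℚᵘ-fromℚᵘ p) (toℚᵘ-fromℚᵘ q)))))

  nat-homo-+ : ∀ m n → nat (m ℕ.+ n) ≡ nat m + nat n
  nat-homo-+ m n =
    trans (fromℚᵘ-cong {natᵘ (m ℕ.+ n)} {natᵘ m ℚᵘ.+ natᵘ n}
                       (*≡* (cross-multiplied (+ m) (+ n))))
          (fromℚᵘ-homo-+ (natᵘ m) (natᵘ n))
    where
    cross-multiplied : ∀ x y → (x ℤ.+ y) ℤ.* + 1 ≡ (x ℤ.* + 1 ℤ.+ y ℤ.* + 1) ℤ.* + 1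
    cross-multiplied = solve-∀

  frac-*-nat : ∀ a d b c .{{_ : NonZero d}} → a ℕ.* b ≡ d ℕ.* c → frac a d * nat b ≡ nat c
  frac-*-nat a d@(suc d-1) b c ab≡dc =
    trans (sym (fromℚᵘ-homo-* (fracᵘ a d-1) (natᵘ b)))
          (fromℚᵘ-cong {fracᵘ a d-1 ℚᵘ.* natᵘ b} {natᵘ c} (*≡* (begin
      (+ a ℤ.* + b) ℤ.* + 1  ≡⟨ cong (ℤ._* + 1) (trans (sym (ℤ.pos-* a b))
                                                  (trans (cong +_ ab≡dc) (ℤ.pos-* d c))) ⟩
      (+ d ℤ.* + c) ℤ.* + 1  ≡⟨ rearrange (+ d) (+ c) ⟩
      + c ℤ.* (+ d ℤ.* + 1)  ∎)))
    where
    open ≡-Reasoning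
    rearrange : ∀ x y → (x ℤ.* y) ℤ.* + 1 ≡ y ℤ.* (x ℤ.* + 1)
    rearrange = solve-∀

module PolynomialAlgebra where
  open import Algebra.Bundles using (CommutativeMonoid)
  open import Data.Nat as ℕ using (zero; suc; _≤_)
  open import Data.Nat.Properties using (m≤n+m; m<n⇒m<1+n; n<1+n)
  open import Data.Rational using (ℚ; 0ℚ; 1ℚ; _+_; _*_)
  open import Data.Rational.Properties
    using (+-assoc; +-identityˡ; +-identityʳ; +-0-commutativeMonoid; *-assoc; *-comm; *-zeroʳ;
           *-distribˡ-+; *-distribʳ-+)
  open import Algebra.Properties.CommutativeSemigroup
    (CommutativeMonoid.commutativeSemigroup +-0-commutativeMonoid) using (interchange)
  open import Level using (0ℓ)
  open import Relation.Binary.Bundles using (Setoid)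
  open import Relation.Binary.PropositionalEquality using (_≡_; refl; sym; trans; cong; cong₂)
  import Relation.Binary.Reasoning.Setoid as SetoidReasoning

  0ₚ : Poly
  0ₚ = const 0ℚ

  two : ℚ
  two = 1ℚ + 1ℚ

  0ₚ-coeff : ∀ k → 0ₚ k ≡ 0ℚ
  0ₚ-coeff zero    = refl
  0ₚ-coeff (suc k) = refl

  ≈ₚ-setoid : Setoid 0ℓ 0ℓ
  ≈ₚ-setoid = record
    { Carrier       = Poly
    ; _≈_           = _≈ₚ_
    ; isEquivalence = record
      { refl  = λ _ → refl
      ; sym   = λ p≈q k → sym (p≈q k)
      ; trans = λ p≈q q≈r k → trans (p≈q k) (q≈r k)
      }
    }

  open Setoid ≈ₚ-setoid public using ()
    renaming (refl to ≈ₚ-refl; reflexive to ≈ₚ-reflexive; sym to ≈ₚ-sym; trans to ≈ₚ-trans)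
  module ≈ₚ-Reasoning = SetoidReasoning ≈ₚ-setoid

  ⊕-cong : ∀ {p q r s} → p ≈ₚ q → r ≈ₚ s → p ⊕ r ≈ₚ q ⊕ s
  ⊕-cong p≈q r≈s k = cong₂ _+_ (p≈q k) (r≈s k)

  ⊕-congˡ : ∀ p {q r} → q ≈ₚ r → p ⊕ q ≈ₚ p ⊕ r
  ⊕-congˡ p = ⊕-cong {p} ≈ₚ-refl

  ⊕-congʳ : ∀ r {p q} → p ≈ₚ q → p ⊕ r ≈ₚ q ⊕ r
  ⊕-congʳ r p≈q = ⊕-cong p≈q (≈ₚ-refl {r})

  ⊕-assoc : ∀ p q r → (p ⊕ q) ⊕ r ≈ₚ p ⊕ (q ⊕ r)
  ⊕-assoc p q r k = +-assoc (p k) (q k) (r k)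

  ⊕-identityˡ : ∀ p → 0ₚ ⊕ p ≈ₚ p
  ⊕-identityˡ p k = trans (cong (_+ p k) (0ₚ-coeff k)) (+-identityˡ (p k))

  ⊕-identityʳ : ∀ p → p ⊕ 0ₚ ≈ₚ p
  ⊕-identityʳ p k = trans (cong (p k +_) (0ₚ-coeff k)) (+-identityʳ (p k))

  ⊕-interchange : ∀ p q r s → (p ⊕ q) ⊕ (r ⊕ s) ≈ₚ (p ⊕ r) ⊕ (q ⊕ s)
  ⊕-interchange p q r s k = interchange (p k) (q k) (r k) (s k)

  ·-distribʳ-+ : ∀ a b p → (a + b) · p ≈ₚ a · p ⊕ b · p
  ·-distribʳ-+ a b p k = *-distribʳ-+ (p k) a b

  twoX*-cong : ∀ {p q} → p ≈ₚ q → twoX* p ≈ₚ twoX* q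
  twoX*-cong p≈q zero    = refl
  twoX*-cong p≈q (suc k) = cong (two *_) (p≈q k)

  twoX*-zero : twoX* 0ₚ ≈ₚ 0ₚ
  twoX*-zero zero    = refl
  twoX*-zero (suc k) = trans (cong (two *_) (0ₚ-coeff k)) (*-zeroʳ two)

  twoX*0ₚ-⊕-identityˡ : ∀ p → twoX* 0ₚ ⊕ p ≈ₚ p
  twoX*0ₚ-⊕-identityˡ p = ≈ₚ-trans (⊕-congʳ p twoX*-zero) (⊕-identityˡ p)

  twoX*-distrib-⊕ : ∀ p q → twoX* (p ⊕ q) ≈ₚ twoX* p ⊕ twoX* q
  twoX*-distrib-⊕ p q zero    = refl
  twoX*-distrib-⊕ p q (suc k) = *-distribˡ-+ two (p k) (q k)

  twoX*-· : ∀ a p → twoX* (a · p) ≈ₚ a · twoX* p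
  twoX*-· a p zero    = sym (*-zeroʳ a)
  twoX*-· a p (suc k) =
    trans (sym (*-assoc two a (p k))) (trans (cong (_* p k) (*-comm two a)) (*-assoc a two (p k)))

  ΣP-cong : ∀ m {f g} → (∀ j → j ℕ.< m → f j ≈ₚ g j) → ΣP m f ≈ₚ ΣP m g
  ΣP-cong zero    f≈g = ≈ₚ-refl
  ΣP-cong (suc m) f≈g = ⊕-cong (ΣP-cong m (λ j j<m → f≈g j (m<n⇒m<1+n j<m))) (f≈g m (n<1+n m))

  ΣP-peel : ∀ m f → ΣP (suc m) f ≈ₚ f 0 ⊕ ΣP m (λ j → f (suc j))
  ΣP-peel zero    f = ≈ₚ-trans (⊕-identityˡ (f 0)) (≈ₚ-sym (⊕-identityʳ (f 0)))
  ΣP-peel (suc m) f = ≈ₚ-trans (⊕-congʳ (f (suc m)) (ΣP-peel m f)) (⊕-assoc (f 0) _ _)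

  ΣP-⊕ : ∀ m f g → ΣP m (λ j → f j ⊕ g j) ≈ₚ ΣP m f ⊕ ΣP m g
  ΣP-⊕ zero    f g = ≈ₚ-sym (⊕-identityˡ 0ₚ)
  ΣP-⊕ (suc m) f g =
    ≈ₚ-trans (⊕-congʳ (f m ⊕ g m) (ΣP-⊕ m f g)) (⊕-interchange (ΣP m f) (ΣP m g) (f m) (g m))

  twoX*-ΣP : ∀ m f → twoX* (ΣP m f) ≈ₚ ΣP m (λ j → twoX* f j)
  twoX*-ΣP zero    f = twoX*-zero
  twoX*-ΣP (suc m) f =
    ≈ₚ-trans (twoX*-distrib-⊕ (ΣP m f) (f m)) (⊕-congʳ (twoX* f m) (twoX*-ΣP m f))

  ΣP-pad : ∀ d m f → (∀ j → m ≤ j → f j ≈ₚ 0ₚ) → ΣP (d ℕ.+ m) f ≈ₚ ΣP m f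
  ΣP-pad zero    m f vanish = ≈ₚ-refl
  ΣP-pad (suc d) m f vanish =
    ≈ₚ-trans (⊕-cong (ΣP-pad d m f vanish) (vanish (d ℕ.+ m) (m≤n+m m d)))
             (⊕-identityʳ (ΣP m f))

module DiagonalSum where
  open import Data.Nat
  open import Data.Nat.Properties using (+-cancelˡ-<; *-suc; <-≤-trans; m≤n*m)
  open import Data.Nat.Tactic.RingSolver using (solve-∀)
  import Data.Rational as ℚ
  open import Relation.Binary.PropositionalEquality using (_≡_; refl; sym; trans; cong; subst)
  open Binomial
  open RationalEmbedding
  open PolynomialAlgebra

  mono : ℕ → ℕ → Poly
  mono k ℓ = nat (coeff k ℓ) · twoXpow k

  mono-zero-suc : ∀ ℓ → mono 0 (suc ℓ) ≡ mono 0 ℓ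
  mono-zero-suc ℓ = cong (λ c → nat c · twoXpow 0) (trans (coeff-zero (suc ℓ)) (sym (coeff-zero ℓ)))

  mono-suc-zero : ∀ k → mono (suc (suc k)) 0 ≈ₚ twoX* mono (suc k) 0
  mono-suc-zero k = ≈ₚ-sym (twoX*-· (nat 1) (twoXpow (suc k)))

  mono-suc-suc : ∀ k ℓ → mono (suc k) (suc ℓ) ≈ₚ twoX* mono k (suc ℓ) ⊕ mono (suc k) ℓ
  mono-suc-suc k ℓ = begin
    nat (coeff (suc k) (suc ℓ)) · twoXpow (suc k)
      ≡⟨ cong (_· twoXpow (suc k)) (trans (cong nat (coeff-suc-suc k ℓ)) (nat-homo-+ a b)) ⟩
    (nat a ℚ.+ nat b) · twoXpow (suc k)
      ≈⟨ ·-distribʳ-+ (nat a) (nat b) (twoXpow (suc k)) ⟩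
    nat a · twoX* twoXpow k ⊕ mono (suc k) ℓ
      ≈⟨ ⊕-congʳ (mono (suc k) ℓ) (twoX*-· (nat a) (twoXpow k)) ⟨
    twoX* mono k (suc ℓ) ⊕ mono (suc k) ℓ ∎
    where
    open ≈ₚ-Reasoning
    a = coeff k (suc ℓ)
    b = coeff (suc k) ℓ

  -- term n i ℓ = mono (n ∸ 3i) ℓ if 3i ≤ n, and 0ₚ otherwise.  Keeping the shift i apart
  -- from ℓ makes n ↦ n + 3 a definitional step while term-rec moves ℓ alone.
  term : ℕ → ℕ → ℕ → Poly
  term n                   zero    ℓ = mono n ℓ
  term (suc (suc (suc n))) (suc i) ℓ = term n i ℓ
  term _                   (suc i) _ = 0ₚ

  term-rec : ∀ n i ℓ → term n i (suc ℓ) ≈ₚ twoX* term (2 + n) (suc i) (suc ℓ) ⊕ term n i ℓ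
  term-rec zero                zero    ℓ =
    ≈ₚ-trans (≈ₚ-reflexive (mono-zero-suc ℓ)) (≈ₚ-sym (twoX*0ₚ-⊕-identityˡ (mono 0 ℓ)))
  term-rec (suc n)             zero    ℓ = mono-suc-suc n ℓ
  term-rec (suc (suc (suc n))) (suc i) ℓ = term-rec n i ℓ
  term-rec zero                (suc i) ℓ = ≈ₚ-sym (twoX*0ₚ-⊕-identityˡ 0ₚ)
  term-rec (suc zero)          (suc i) ℓ = ≈ₚ-sym (twoX*0ₚ-⊕-identityˡ 0ₚ)
  term-rec (suc (suc zero))    (suc i) ℓ = ≈ₚ-sym (twoX*0ₚ-⊕-identityˡ 0ₚ)

  term-at : ∀ i k ℓ → term (3 * i + k) i ℓ ≡ mono k ℓ
  term-at zero    k ℓ = refl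
  term-at (suc i) k ℓ =
    subst (λ n → term n (suc i) ℓ ≡ mono k ℓ) (sym (shift i k)) (term-at i k ℓ)
    where
    shift : ∀ i k → 3 * suc i + k ≡ 3 + (3 * i + k)
    shift = solve-∀

  term-vanishes : ∀ n i ℓ → n < 3 * i → term n i ℓ ≡ 0ₚ
  term-vanishes (suc (suc (suc n))) (suc i) ℓ n<3i =
    term-vanishes n i ℓ (+-cancelˡ-< 3 n (3 * i) (subst (3 + n <_) (*-suc 3 i) n<3i))
  term-vanishes zero             (suc i) ℓ _ = refl
  term-vanishes (suc zero)       (suc i) ℓ _ = refl
  term-vanishes (suc (suc zero)) (suc i) ℓ _ = refl

  diagonal : ℕ → ℕ → Poly
  diagonal n ℓ = term n ℓ ℓ

  diagonal-vanishes : ∀ n j → n < j → diagonal n j ≈ₚ 0ₚ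
  diagonal-vanishes n j n<j = ≈ₚ-reflexive (term-vanishes n j j (<-≤-trans n<j (m≤n*m j 3)))

  -- Summing over all ℓ ≤ n (the terms with 3ℓ > n vanish) keeps the range independent of n mod 3.
  diagonalSum : ℕ → Poly
  diagonalSum n = ΣP (suc n) (diagonal n)

  diagonalSum-rec : ∀ n → diagonalSum (3 + n) ≈ₚ twoX* diagonalSum (2 + n) ⊕ diagonalSum n
  diagonalSum-rec n = begin
    diagonalSum (3 + n)
      ≈⟨ ΣP-peel (3 + n) (diagonal (3 + n)) ⟩
    mono (3 + n) 0 ⊕ ΣP (3 + n) (λ ℓ → term n ℓ (suc ℓ))
      ≈⟨ ⊕-congˡ (mono (3 + n) 0) (ΣP-cong (3 + n) (λ ℓ _ → term-rec n ℓ ℓ)) ⟩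
    mono (3 + n) 0 ⊕ ΣP (3 + n) (λ ℓ → twoX* tail ℓ ⊕ diagonal n ℓ)
      ≈⟨ ⊕-congˡ (mono (3 + n) 0) (ΣP-⊕ (3 + n) (λ ℓ → twoX* tail ℓ) (diagonal n)) ⟩
    mono (3 + n) 0 ⊕ (ΣP (3 + n) (λ ℓ → twoX* tail ℓ) ⊕ ΣP (3 + n) (diagonal n))
      ≈⟨ ⊕-assoc (mono (3 + n) 0) _ _ ⟨
    (mono (3 + n) 0 ⊕ ΣP (3 + n) (λ ℓ → twoX* tail ℓ)) ⊕ ΣP (3 + n) (diagonal n)
      ≈⟨ ⊕-cong (⊕-cong (mono-suc-zero (suc n)) (≈ₚ-sym (twoX*-ΣP (3 + n) tail)))
                (ΣP-pad 2 (suc n) (diagonal n) (diagonal-vanishes n)) ⟩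
    (twoX* mono (2 + n) 0 ⊕ twoX* ΣP (3 + n) tail) ⊕ diagonalSum n
      ≈⟨ ⊕-congʳ (diagonalSum n) (twoX*-distrib-⊕ (mono (2 + n) 0) (ΣP (3 + n) tail)) ⟨
    twoX* (mono (2 + n) 0 ⊕ ΣP (3 + n) tail) ⊕ diagonalSum n
      ≈⟨ ⊕-congʳ (diagonalSum n)
           (twoX*-cong (⊕-congˡ (mono (2 + n) 0) (ΣP-pad 1 (2 + n) tail tail-vanishes))) ⟩
    twoX* (mono (2 + n) 0 ⊕ ΣP (2 + n) tail) ⊕ diagonalSum n
      ≈⟨ ⊕-congʳ (diagonalSum n) (twoX*-cong (ΣP-peel (2 + n) (diagonal (2 + n)))) ⟨
    twoX* diagonalSum (2 + n) ⊕ diagonalSum n ∎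
    where
    open ≈ₚ-Reasoning
    tail : ℕ → Poly
    tail ℓ = diagonal (2 + n) (suc ℓ)
    tail-vanishes : ∀ j → 2 + n ≤ j → tail j ≈ₚ 0ₚ
    tail-vanishes j 2+n≤j = diagonal-vanishes (2 + n) (suc j) (s≤s 2+n≤j)

  σ≈diagonalSum : ∀ n → σ n ≈ₚ diagonalSum n
  σ≈diagonalSum zero                zero                = refl
  σ≈diagonalSum zero                (suc k)             = refl
  σ≈diagonalSum (suc zero)          zero                = refl
  σ≈diagonalSum (suc zero)          (suc zero)          = refl
  σ≈diagonalSum (suc zero)          (suc (suc k))       = refl
  σ≈diagonalSum (suc (suc zero))    zero                = refl
  σ≈diagonalSum (suc (suc zero))    (suc zero)          = refl
  σ≈diagonalSum (suc (suc zero))    (suc (suc zero))    = refl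
  σ≈diagonalSum (suc (suc zero))    (suc (suc (suc k))) = refl
  σ≈diagonalSum (suc (suc (suc n)))                     =
    ≈ₚ-trans (⊕-cong (twoX*-cong (σ≈diagonalSum (suc (suc n)))) (σ≈diagonalSum n))
             (≈ₚ-sym (diagonalSum-rec n))

module PaperFormula where
  open import Data.Nat
  open import Data.Nat.Properties
    using (≤-trans; ≤-reflexive; ≤-pred; *-comm; *-monoˡ-≤; ≰⇒>; <⇒≱; +-suc;
           m+n∸m≡n; m+[n∸m]≡n; m∸n+n≡m)
  open import Data.Nat.Combinatorics using (_C_)
  open import Data.Nat.DivMod using (_/_; m/n*n≤m; m/n≤m; m*n/n≡m; /-monoˡ-≤)
  open import Data.Nat.Tactic.RingSolver using (solve-∀)
  import Data.Rational as ℚ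
  open import Relation.Binary.PropositionalEquality
    using (_≡_; sym; trans; cong; cong₂; subst; module ≡-Reasoning)
  open Binomial
  open RationalEmbedding
  open PolynomialAlgebra
  open DiagonalSum

  summand : ℕ → ℕ → Poly
  summand n ℓ = (frac n (n ∸ 2 * ℓ) ℚ.* nat ((n ∸ 2 * ℓ) C ℓ)) · twoXpow (n ∸ 3 * ℓ)

  paper-coefficient : ∀ k ℓ → 1 ≤ 3 * ℓ + k →
                      frac (3 * ℓ + k) (ℓ + k) ℚ.* nat ((ℓ + k) C ℓ) ≡ nat (coeff k ℓ)
  paper-coefficient zero    zero    ()
  paper-coefficient (suc k) zero    _ = frac-*-nat (suc k) (suc k) 1 1 (coeff-closedForm (suc k) 0)
  paper-coefficient k       (suc j) _ =
    frac-*-nat (3 * suc j + k) (suc (j + k)) (suc (j + k) C suc j) (coeff k (suc j))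
               (coeff-closedForm k (suc j))

  summand-at : ∀ ℓ k → 1 ≤ 3 * ℓ + k → summand (3 * ℓ + k) ℓ ≡ mono k ℓ
  summand-at ℓ k 1≤n = begin
    summand (3 * ℓ + k) ℓ
      ≡⟨ cong₂ (λ d m → (frac (3 * ℓ + k) d ℚ.* nat (d C ℓ)) · twoXpow m)
               n∸2ℓ≡ℓ+k (m+n∸m≡n (3 * ℓ) k) ⟩
    (frac (3 * ℓ + k) (ℓ + k) ℚ.* nat ((ℓ + k) C ℓ)) · twoXpow k
      ≡⟨ cong (_· twoXpow k) (paper-coefficient k ℓ 1≤n) ⟩
    mono k ℓ ∎
    where
    open ≡-Reasoning
    split : ∀ ℓ k → 3 * ℓ + k ≡ 2 * ℓ + (ℓ + k)
    split = solve-∀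
    n∸2ℓ≡ℓ+k : 3 * ℓ + k ∸ 2 * ℓ ≡ ℓ + k
    n∸2ℓ≡ℓ+k = trans (cong (_∸ 2 * ℓ) (split ℓ k)) (m+n∸m≡n (2 * ℓ) (ℓ + k))

  summand≡diagonal : ∀ n ℓ → 1 ≤ n → 3 * ℓ ≤ n → summand n ℓ ≡ diagonal n ℓ
  summand≡diagonal n ℓ 1≤n 3ℓ≤n = begin
    summand n ℓ            ≡⟨ cong (λ m → summand m ℓ) n≡3ℓ+k ⟩
    summand (3 * ℓ + k) ℓ  ≡⟨ summand-at ℓ k (subst (1 ≤_) n≡3ℓ+k 1≤n) ⟩
    mono k ℓ               ≡⟨ term-at ℓ k ℓ ⟨
    term (3 * ℓ + k) ℓ ℓ   ≡⟨ cong (λ m → term m ℓ ℓ) n≡3ℓ+k ⟨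
    term n ℓ ℓ             ∎
    where
    open ≡-Reasoning
    k = n ∸ 3 * ℓ
    n≡3ℓ+k : n ≡ 3 * ℓ + k
    n≡3ℓ+k = sym (m+[n∸m]≡n 3ℓ≤n)

  j≤n/3⇒3j≤n : ∀ {n j} → j ≤ n / 3 → 3 * j ≤ n
  j≤n/3⇒3j≤n {n} {j} j≤n/3 =
    ≤-trans (≤-reflexive (*-comm 3 j)) (≤-trans (*-monoˡ-≤ 3 j≤n/3) (m/n*n≤m n 3))

  n/3<j⇒n<3j : ∀ {n j} → n / 3 < j → n < 3 * j
  n/3<j⇒n<3j {n} {j} n/3<j = ≰⇒> λ 3j≤n →
    <⇒≱ n/3<j (subst (_≤ n / 3) (m*n/n≡m j 3) (/-monoˡ-≤ 3 (subst (_≤ n) (*-comm 3 j) 3j≤n)))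

  rhs≈diagonalSum : ∀ n → 1 ≤ n → rhs n ≈ₚ diagonalSum n
  rhs≈diagonalSum n 1≤n = begin
    ΣP (suc (n / 3)) (summand n)
      ≈⟨ ΣP-cong (suc (n / 3)) (λ j j<1+n/3 →
           ≈ₚ-reflexive (summand≡diagonal n j 1≤n (j≤n/3⇒3j≤n (≤-pred j<1+n/3)))) ⟩
    ΣP (suc (n / 3)) (diagonal n)
      ≈⟨ ΣP-pad (n ∸ n / 3) (suc (n / 3)) (diagonal n) (λ j n/3<j →
           ≈ₚ-reflexive (term-vanishes n j j (n/3<j⇒n<3j n/3<j))) ⟨
    ΣP (n ∸ n / 3 + suc (n / 3)) (diagonal n)
      ≡⟨ cong (λ m → ΣP m (diagonal n))
              (trans (+-suc (n ∸ n / 3) (n / 3)) (cong suc (m∸n+n≡m (m/n≤m n 3)))) ⟩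
    diagonalSum n ∎
    where open ≈ₚ-Reasoning

open PolynomialAlgebra using (≈ₚ-trans; ≈ₚ-sym)
open DiagonalSum using (σ≈diagonalSum)
open PaperFormula using (rhs≈diagonalSum)

mainTheorem7 : ∀ (n : ℕ) → n ≥ 1 → σ n ≈ₚ rhs n
mainTheorem7 n n≥1 = ≈ₚ-trans (σ≈diagonalSum n) (≈ₚ-sym (rhs≈diagonalSum n n≥1))
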